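{- Let $G$ be a graph of treewidth at most $w$ and $R\subseteq V(G)$ with $|R|\ge 2$. Then every Non-pendant $R$-CIST of $G$ has size at most $w+1$.
   Context: Graphs are finite and connected, may have parallel edges but no loops; treewidth is the usual treewidth (of the underlying simple graph). For a tree $T$, $\mathrm{int}(T)$ is the set of vertices of degree at least 2 and $L(T)$ the set of leaves. An $R$-Steiner tree is a subtree $T$ with $R\subseteq V(T)$ and $L(T)\subseteq R$; it is non-pendant if $\mathrm{int}(T)\cap R\ne\emptyset$. $T(u,v)$ is the unique $(u,v)$-path in $T$. An $R$-CIST of size $k$ is a set $\{T_1,\dots,T_k\}$ of $R$-Steiner trees such that for all distinct $u,v\in R$ and distinct $i,j$, $T_i(u,v)$ and $T_j(u,v)$ are edge-disjoint and internally vertex-disjoint; it is a Non-pendant $R$-CIST if all its trees are non-pendant. -}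

module Defs where

open import Data.Nat using (ℕ; zero; suc; _≤_)
open import Data.Fin using (Fin)
open import Data.Fin.Properties using (_≟_)
open import Data.Fin.Subset using (Subset; _∈_; _∉_; _⊆_; ∣_∣; ⊤)
open import Data.Bool using (Bool; _∧_; _∨_)
open import Data.Vec using (tabulate; lookup)
open import Data.Product using (Σ; ∃; ∃-syntax; _×_; _,_; proj₁; proj₂)
open import Data.Sum using (_⊎_)
open import Data.List using (List; []; _∷_)
open import Data.List.Relation.Unary.Unique.Propositional using (Unique)
import Data.List.Membership.Propositional as LM
open import Relation.Nullary using (¬_)
open import Relation.Nullary.Decidable using (isYes)
open import Relation.Binary.PropositionalEquality using (_≡_; _≢_)

-- Finite multigraphs without loops (parallel edges allowed).
-- Vertices are Fin nV, edges are Fin nE; each edge has two endpoints.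

record Graph : Set where
  field
    nV : ℕ
    nE : ℕ
    ends : Fin nE → Fin nV × Fin nV
    loopless : ∀ e → proj₁ (ends e) ≢ proj₂ (ends e)
open Graph public

Joins : (G : Graph) → Fin (nE G) → Fin (nV G) → Fin (nV G) → Set
Joins G e u w = (ends G e ≡ (u , w)) ⊎ (ends G e ≡ (w , u))

data Walk (G : Graph) (S : Subset (nE G)) : Fin (nV G) → Fin (nV G) → Set where
  []   : ∀ {u} → Walk G S u u
  step : ∀ {u w v} (e : Fin (nE G)) → e ∈ S → Joins G e u w → Walk G S w v → Walk G S u v

module _ {G : Graph} {S : Subset (nE G)} where
  later : ∀ {u v} → Walk G S u v → List (Fin (nV G))
  later [] = []
  later (step {w = w} e _ _ p) = w ∷ later p

  verts : ∀ {u v} → Walk G S u v → List (Fin (nV G))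
  verts {u} p = u ∷ later p

  inner : ∀ {u v} → Walk G S u v → List (Fin (nV G))
  inner [] = []
  inner (step e _ _ []) = []
  inner (step {w = w} e _ _ p@(step _ _ _ _)) = w ∷ inner p

  edges : ∀ {u v} → Walk G S u v → List (Fin (nE G))
  edges [] = []
  edges (step e _ _ p) = e ∷ edges p

record Path (G : Graph) (S : Subset (nE G)) (u v : Fin (nV G)) : Set where
  constructor path
  field
    walk : Walk G S u v
    simple : Unique (verts walk)
open Path public

-- a cycle in the edge set S: an edge e ∈ S joining u,w, closed up by a
-- path from w back to u in S not using e (length-2 cycles from parallel
-- edges are included)
Cycle : (G : Graph) → Subset (nE G) → Set
Cycle G S = Σ (Fin (nE G)) λ e → Σ (Fin (nV G)) λ u → Σ (Fin (nV G)) λ w →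
  e ∈ S × Joins G e u w ×
  Σ (Path G S w u) λ p → ¬ (e LM.∈ edges (walk p))

record IsTree (G : Graph) (VT : Subset (nV G)) (ET : Subset (nE G)) : Set where
  field
    closed : ∀ e → e ∈ ET → proj₁ (ends G e) ∈ VT × proj₂ (ends G e) ∈ VT
    connected : ∀ u v → u ∈ VT → v ∈ VT → Path G ET u v
    acyclic : ¬ Cycle G ET

deg : (G : Graph) → Subset (nE G) → Fin (nV G) → ℕ
deg G ET v = ∣ tabulate (λ e → lookup ET e ∧
               (isYes (proj₁ (ends G e) ≟ v) ∨ isYes (proj₂ (ends G e) ≟ v))) ∣

IsConnected : Graph → Set
IsConnected G = ∀ u v → Path G ⊤ u v

record Subtree (G : Graph) : Set where
  field
    VT : Subset (nV G)
    ET : Subset (nE G)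
    isTree : IsTree G VT ET
open Subtree public

IsLeaf : (G : Graph) → Subtree G → Fin (nV G) → Set
IsLeaf G T v = v ∈ VT T × deg G (ET T) v ≡ 1

IsInternal : (G : Graph) → Subtree G → Fin (nV G) → Set
IsInternal G T v = v ∈ VT T × 2 ≤ deg G (ET T) v

IsSteiner : (G : Graph) → Subset (nV G) → Subtree G → Set
IsSteiner G R T = (R ⊆ VT T) × (∀ v → IsLeaf G T v → v ∈ R)

IsNonPendant : (G : Graph) → Subset (nV G) → Subtree G → Set
IsNonPendant G R T = ∃[ v ] (v ∈ R × IsInternal G T v)

PathsDisjoint : {G : Graph} {S₁ S₂ : Subset (nE G)} {u v : Fin (nV G)} →
  Path G S₁ u v → Path G S₂ u v → Set
PathsDisjoint p q =
  (∀ e → e LM.∈ edges (walk p) → ¬ (e LM.∈ edges (walk q))) ×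
  (∀ x → x LM.∈ inner (walk p) → ¬ (x LM.∈ inner (walk q)))

-- an R-CIST of size k, given as a family of k subtrees: all are
-- R-Steiner trees, and for distinct u,v ∈ R and distinct i,j the paths
-- T_i(u,v) and T_j(u,v) are edge-disjoint and internally vertex-disjoint.
-- (T(u,v) is the unique (u,v)-path in the tree T; we quantify over all
-- paths in T between u and v, which by uniqueness is just T(u,v).)
IsCIST : (G : Graph) → Subset (nV G) → (k : ℕ) → (Fin k → Subtree G) → Set
IsCIST G R k T =
  (∀ i → IsSteiner G R (T i)) ×
  (∀ u v → u ∈ R → v ∈ R → u ≢ v → ∀ i j → i ≢ j →
     (p : Path G (ET (T i)) u v) → (q : Path G (ET (T j)) u v) → PathsDisjoint p q)

IsNonPendantCIST : (G : Graph) → Subset (nV G) → (k : ℕ) → (Fin k → Subtree G) → Set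
IsNonPendantCIST G R k T = IsCIST G R k T × (∀ i → IsNonPendant G R (T i))

-- Tree decompositions and treewidth (of the underlying simple graph;
-- parallel edges impose nothing beyond their endpoints sharing a bag).

record TreeDecomposition (G : Graph) : Set where
  field
    D : Graph
    D-tree : IsTree D ⊤ ⊤
    bag : Fin (nV D) → Subset (nV G)
    cover-v : ∀ v → ∃[ a ] (v ∈ bag a)
    cover-e : ∀ e → ∃[ a ] (proj₁ (ends G e) ∈ bag a × proj₂ (ends G e) ∈ bag a)
    coherent : ∀ v a b → v ∈ bag a → v ∈ bag b → (p : Path D ⊤ a b) →
               ∀ c → c LM.∈ verts (walk p) → v ∈ bag c
open TreeDecomposition public

WidthAtMost : {G : Graph} → TreeDecomposition G → ℕ → Set
WidthAtMost TD w = ∀ a → ∣ bag TD a ∣ ≤ suc w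

TreewidthAtMost : Graph → ℕ → Set
TreewidthAtMost G w = ∃[ TD ] WidthAtMost {G} TD w

module Submission where

-- Two trees Tᵢ ≠ Tⱼ of an R-CIST share no internal vertex r: r lies on a path between two
-- leaves of Tᵢ, which belong to R, so r cuts R ∖ {r} in Tᵢ, and likewise in Tⱼ; but whenever
-- r cuts x from y in Tᵢ it is an inner vertex of Tᵢ(x, y), so Tⱼ(x, y) avoids it, and two
-- such "cut" equivalence relations cannot both be nontrivial.
-- If there were k > w + 1 trees, then for any set S of at most w + 1 vertices one of the k
-- internally disjoint paths Tᵢ(x, y) misses S inside, so no adhesion set of a decomposition of
-- width w separates two vertices of R. Hence walking in the decomposition tree from a bag
-- towards a bag holding a vertex of R that it misses never turns back, and ends in a bag
-- containing all of R. The non-pendant trees then give k distinct internal vertices of R in a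
-- bag of size at most w + 1.

open import Defs
open import Data.Bool using (Bool; true; _∧_; _∨_)
open import Data.Empty using (⊥)
open import Data.Fin using (Fin)
open import Data.Fin.Properties using (_≟_; any?)
open import Data.Fin.Subset using (Subset; _∈_; _∉_; _-_; _∩_; _⊆_; ∣_∣; ⊤; ⁅_⁆; Nonempty)
open import Data.Fin.Subset.Properties
  using (_∈?_; ∈⊤; ∣⊤∣≡n; x∈p∩q⁺; x∈p∩q⁻; ∣p∩q∣≤∣p∣; x∈p∧x≢y⇒x∈p-y; x∈p⇒∣p-x∣<∣p∣;
         nonempty?; Empty-unique; ∣⊥∣≡0; ∣⁅x⁆∣≡1; x∈⁅x⁆; x∈⁅y⁆⇒x≡y; ⊆-antisym)
open import Data.List using (List; []; _∷_; length)
open import Data.List.Properties using (length-tabulate)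
open import Data.List.Membership.Propositional using (find) renaming (_∈_ to _∈ₗ_; _∉_ to _∉ₗ_)
import Data.List.Membership.DecPropositional as DecMembership
open import Data.List.Relation.Binary.Disjoint.Propositional using (Disjoint)
open import Data.List.Relation.Binary.Subset.Propositional using () renaming (_⊆_ to _⊆ₗ_)
open import Data.List.Relation.Unary.All using (All; []; _∷_)
import Data.List.Relation.Unary.All as All
open import Data.List.Relation.Unary.All.Properties using (¬Any⇒All¬)
import Data.List.Relation.Unary.All.Properties as Allₚ
open import Data.List.Relation.Unary.AllPairs using ([]; _∷_)
open import Data.List.Relation.Unary.Any using (Any; here; there)
import Data.List.Relation.Unary.Any as Any
open import Data.List.Relation.Unary.Unique.Propositional using (Unique)
open import Data.List.Relation.Unary.Unique.Propositional.Properties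
  using (Unique[x∷xs]⇒x∉xs; tabulate⁺)
open import Data.Nat using (ℕ; zero; suc; _+_; _≤_; _<_; z≤n; s≤s)
open import Data.Nat.Properties
  using (≮⇒≥; ≤-trans; ≤-<-trans; <⇒≱; +-suc; +-identityʳ; m≤n+m)
open import Data.Product using (Σ; ∃; ∃₂; _×_; _,_; proj₁; proj₂)
open import Data.Sum using (_⊎_; inj₁; inj₂; [_,_]′)
import Data.Sum as Sum
open import Data.Unit using (tt) renaming (⊤ to Unit)
open import Data.Vec using (tabulate; lookup)
open import Data.Vec.Properties using (lookup∘tabulate; lookup⇒[]=; []=⇒lookup)
open import Function using (_∘_; id)
open import Relation.Binary.PropositionalEquality
  using (_≡_; _≢_; refl; sym; trans; cong; cong₂; subst)
open import Relation.Binary.Structures using (IsPartialEquivalence)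
open import Relation.Nullary using (¬_; Dec; yes; no; contradiction)
open import Relation.Nullary.Decidable using (isYes; _×-dec_; ¬?; ¬¬-excluded-middle; decidable-stable)

_∈ₗ?_ : ∀ {n} (x : Fin n) (xs : List (Fin n)) → Dec (x ∈ₗ xs)
x ∈ₗ? xs = DecMembership._∈?_ _≟_ x xs

unique-∷ : ∀ {A : Set} {x : A} {xs} → x ∉ₗ xs → Unique xs → Unique (x ∷ xs)
unique-∷ {xs = xs} x∉xs xs! = ¬Any⇒All¬ xs x∉xs ∷ xs!

unique⊆⇒length≤ : ∀ {n} (S : Subset n) {xs : List (Fin n)} →
  Unique xs → All (_∈ S) xs → length xs ≤ ∣ S ∣
unique⊆⇒length≤ S [] [] = z≤n
unique⊆⇒length≤ S {x ∷ _} (x≢xs ∷ xs!) (x∈S ∷ xs⊆S) =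
  ≤-trans (s≤s (unique⊆⇒length≤ (S - x) xs! (All.zipWith ∈S-x (x≢xs , xs⊆S))))
          (x∈p⇒∣p-x∣<∣p∣ x∈S)
  where
  ∈S-x : ∀ {y} → x ≢ y × y ∈ S → y ∈ S - x
  ∈S-x (x≢y , y∈S) = x∈p∧x≢y⇒x∈p-y y∈S (x≢y ∘ sym)

pigeonhole-⊆ : ∀ {n k} (S : Subset n) (f : Fin k → Fin n) → (∀ i → f i ∈ S) → ∣ S ∣ < k →
  ∃₂ λ i j → i ≢ j × f i ≡ f j
pigeonhole-⊆ {k = k} S f f∈S ∣S∣<k with any? (λ i → any? λ j → ¬? (i ≟ j) ×-dec (f i ≟ f j))
... | yes collision = collision
... | no no-collision = contradiction k≤∣S∣ (<⇒≱ ∣S∣<k)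
  where
  injective : ∀ {i j} → f i ≡ f j → i ≡ j
  injective {i} {j} fi≡fj with i ≟ j
  ... | yes i≡j = i≡j
  ... | no i≢j = contradiction (i , j , i≢j , fi≡fj) no-collision
  k≤∣S∣ : k ≤ ∣ S ∣
  k≤∣S∣ = subst (_≤ ∣ S ∣) (length-tabulate f)
    (unique⊆⇒length≤ S (tabulate⁺ injective) (Allₚ.tabulate⁺ f∈S))

disjoint-lists-cannot-all-meet : ∀ {n k} (xs : Fin k → List (Fin n)) →
  (∀ {i j} → i ≢ j → Disjoint (xs i) (xs j)) → (S : Subset n) → ∣ S ∣ < k →
  ¬ (∀ i → Any (_∈ S) (xs i))
disjoint-lists-cannot-all-meet xs disjoint S ∣S∣<k meets =
  let i , j , i≢j , same = pigeonhole-⊆ S (proj₁ ∘ witness) (proj₂ ∘ proj₂ ∘ witness) ∣S∣<k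
  in  disjoint i≢j (∈xs i , subst (_∈ₗ xs j) (sym same) (∈xs j))
  where
  witness : ∀ i → ∃ λ x → x ∈ₗ xs i × x ∈ S
  witness i = find (meets i)
  ∈xs : ∀ i → proj₁ (witness i) ∈ₗ xs i
  ∈xs i = proj₁ (proj₂ (witness i))

disjoint-lists-avoid : ∀ {n k} (xs : Fin k → List (Fin n)) →
  (∀ {i j} → i ≢ j → Disjoint (xs i) (xs j)) → (S : Subset n) → ∣ S ∣ < k →
  ∃ λ i → All (_∉ S) (xs i)
disjoint-lists-avoid xs disjoint S ∣S∣<k with any? (λ i → ¬? (Any.any? (_∈? S) (xs i)))
... | yes (i , misses) = i , ¬Any⇒All¬ (xs i) misses
... | no every-list-meets = contradiction meets (disjoint-lists-cannot-all-meet xs disjoint S ∣S∣<k)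
  where
  meets : ∀ i → Any (_∈ S) (xs i)
  meets i with Any.any? (_∈? S) (xs i)
  ... | yes m = m
  ... | no m = contradiction (i , m) every-list-meets

1≤∣p∣⇒nonempty : ∀ {n} (p : Subset n) → 1 ≤ ∣ p ∣ → Nonempty p
1≤∣p∣⇒nonempty {n} p 1≤∣p∣ with nonempty? p
... | yes p≠∅ = p≠∅
... | no p=∅ =
  contradiction (subst (1 ≤_) (trans (cong ∣_∣ (Empty-unique p=∅)) (∣⊥∣≡0 n)) 1≤∣p∣) λ ()

∣p∣≡1⊎another : ∀ {n} (p : Subset n) {x} → x ∈ p →
  ∣ p ∣ ≡ 1 ⊎ ∃ λ y → y ∈ p × y ≢ x
∣p∣≡1⊎another p {x} x∈p with any? (λ y → (y ∈? p) ×-dec ¬? (y ≟ x))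
... | yes another = inj₂ another
... | no no-other = inj₁ (trans (cong ∣_∣ (⊆-antisym p⊆⁅x⁆ ⁅x⁆⊆p)) (∣⁅x⁆∣≡1 x))
  where
  p⊆⁅x⁆ : p ⊆ ⁅ x ⁆
  p⊆⁅x⁆ {y} y∈p with y ≟ x
  ... | yes refl = x∈⁅x⁆ x
  ... | no y≢x = contradiction (y , y∈p , y≢x) no-other
  ⁅x⁆⊆p : ⁅ x ⁆ ⊆ p
  ⁅x⁆⊆p y∈⁅x⁆ rewrite x∈⁅y⁆⇒x≡y x y∈⁅x⁆ = x∈p

2≤∣p∣⇒two-elements : ∀ {n} (p : Subset n) → 2 ≤ ∣ p ∣ →
  ∃₂ λ x y → x ∈ p × y ∈ p × y ≢ x
2≤∣p∣⇒two-elements p 2≤∣p∣ with 1≤∣p∣⇒nonempty p (≤-trans (s≤s z≤n) 2≤∣p∣)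
... | x , x∈p with ∣p∣≡1⊎another p x∈p
...   | inj₁ ∣p∣≡1 = contradiction (subst (2 ≤_) ∣p∣≡1 2≤∣p∣) λ { (s≤s ()) }
...   | inj₂ (y , y∈p , y≢x) = x , y , x∈p , y∈p , y≢x

∧-true⁻ : ∀ {x y} → x ∧ y ≡ true → x ≡ true × y ≡ true
∧-true⁻ {true} {true} refl = refl , refl

module _ {A : Set} {P : A → Set} {_≈₁_ _≈₂_ : A → A → Set}
  (equiv₁ : IsPartialEquivalence _≈₁_) (equiv₂ : IsPartialEquivalence _≈₂_)
  (cover : ∀ {x y} → P x → P y → ¬ x ≈₁ y → x ≈₂ y) where
  private
    module E₁ = IsPartialEquivalence equiv₁
    module E₂ = IsPartialEquivalence equiv₂

  -- Some z ∈ {x₁, y₁} is ≈₁-apart from x₂, hence from y₂, and then z ≈₂-links x₂ to y₂.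
  not-both-split : ∀ {x₁ y₁ x₂ y₂} → P x₁ → P y₁ → P x₂ → P y₂ →
    ¬ x₁ ≈₁ y₁ → ¬ x₂ ≈₂ y₂ → ⊥
  not-both-split {x₁} {y₁} {x₂} {y₂} Px₁ Py₁ Px₂ Py₂ x₁≉₁y₁ x₂≉₂y₂ = ¬¬-excluded-middle λ where
      (no x₂≉₁y₂) → x₂≉₂y₂ (cover Px₂ Py₂ x₂≉₁y₂)
      (yes x₂≈₁y₂) → ¬¬-excluded-middle λ where
        (yes x₁≈₁x₂) → apart Py₁ x₂≈₁y₂ λ y₁≈₁x₂ →
                         x₁≉₁y₁ (E₁.trans x₁≈₁x₂ (E₁.sym y₁≈₁x₂))
        (no x₁≉₁x₂) → apart Px₁ x₂≈₁y₂ x₁≉₁x₂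
    where
    apart : ∀ {z} → P z → x₂ ≈₁ y₂ → ¬ z ≈₁ x₂ → ⊥
    apart Pz x₂≈₁y₂ z≉₁x₂ =
      x₂≉₂y₂ (E₂.trans (E₂.sym (cover Pz Px₂ z≉₁x₂)) (cover Pz Py₂ z≉₁y₂))
      where z≉₁y₂ = λ z≈₁y₂ → z≉₁x₂ (E₁.trans z≈₁y₂ (E₁.sym x₂≈₁y₂))

Incident : (G : Graph) → Fin (nE G) → Fin (nV G) → Set
Incident G e v = proj₁ (ends G e) ≡ v ⊎ proj₂ (ends G e) ≡ v

-- e is a module parameter because it cannot be recovered from a value of type Joins G e u w.
module JoinsProperties (G : Graph) (e : Fin (nE G)) where

  Joins-sym : ∀ {u w} → Joins G e u w → Joins G e w u
  Joins-sym (inj₁ eq) = inj₂ eq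
  Joins-sym (inj₂ eq) = inj₁ eq

  Joins⇒Incidentˡ : ∀ {u w} → Joins G e u w → Incident G e u
  Joins⇒Incidentˡ (inj₁ refl) = inj₁ refl
  Joins⇒Incidentˡ (inj₂ refl) = inj₂ refl

  Joins⇒Incidentʳ : ∀ {u w} → Joins G e u w → Incident G e w
  Joins⇒Incidentʳ j = Joins⇒Incidentˡ (Joins-sym j)

  Incident⇒Joins : ∀ {v} → Incident G e v → ∃ (Joins G e v)
  Incident⇒Joins (inj₁ refl) = _ , inj₁ refl
  Incident⇒Joins (inj₂ refl) = _ , inj₂ refl

  Joins⇒≢ : ∀ {u w} → Joins G e u w → u ≢ w
  Joins⇒≢ (inj₁ refl) = loopless G e
  Joins⇒≢ (inj₂ refl) = loopless G e ∘ sym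

  Joins-ends : ∀ {u w} {P : Fin (nV G) → Set} → Joins G e u w →
    P (proj₁ (ends G e)) → P (proj₂ (ends G e)) → P u × P w
  Joins-ends (inj₁ refl) P₁ P₂ = P₁ , P₂
  Joins-ends (inj₂ refl) P₁ P₂ = P₂ , P₁

  Joins-unique : ∀ {c a b} → Joins G e c a → Joins G e c b → a ≡ b
  Joins-unique (inj₁ refl) (inj₁ refl) = refl
  Joins-unique (inj₁ refl) (inj₂ eq) = trans (cong proj₂ eq) (cong proj₁ eq)
  Joins-unique (inj₂ refl) (inj₁ eq) = trans (cong proj₁ eq) (cong proj₂ eq)
  Joins-unique (inj₂ refl) (inj₂ refl) = refl

module Degree (G : Graph) where

  endpoint? : Fin (nE G) → Fin (nV G) → Bool
  endpoint? e v = isYes (proj₁ (ends G e) ≟ v) ∨ isYes (proj₂ (ends G e) ≟ v)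

  -- deg G ET v unfolds to ∣ incident-edges ET v ∣.
  incident-edges : Subset (nE G) → Fin (nV G) → Subset (nE G)
  incident-edges ET v = tabulate λ e → lookup ET e ∧ endpoint? e v

  endpoint?-sound : ∀ {e v} → endpoint? e v ≡ true → Incident G e v
  endpoint?-sound {e} {v} with proj₁ (ends G e) ≟ v | proj₂ (ends G e) ≟ v
  ... | yes eq | _ = λ _ → inj₁ eq
  ... | no _ | yes eq = λ _ → inj₂ eq
  ... | no _ | no _ = λ ()

  endpoint?-complete : ∀ {e v} → Incident G e v → endpoint? e v ≡ true
  endpoint?-complete {e} {v} e∋v with proj₁ (ends G e) ≟ v | proj₂ (ends G e) ≟ v
  ... | yes _ | _ = refl
  ... | no _ | yes _ = refl
  ... | no ≢₁ | no ≢₂ = contradiction e∋v [ ≢₁ , ≢₂ ]′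

  ∈-incident⁺ : ∀ {ET e v} → e ∈ ET → Incident G e v → e ∈ incident-edges ET v
  ∈-incident⁺ {ET} {e} e∈ET e∋v = lookup⇒[]= e _
    (trans (lookup∘tabulate _ e) (cong₂ _∧_ ([]=⇒lookup e∈ET) (endpoint?-complete e∋v)))

  ∈-incident⁻ : ∀ {ET e v} → e ∈ incident-edges ET v → e ∈ ET × Incident G e v
  ∈-incident⁻ {ET} {e} e∈inc =
    let e∈ET , e∋v = ∧-true⁻ (trans (sym (lookup∘tabulate _ e)) ([]=⇒lookup e∈inc))
    in  lookup⇒[]= e ET e∈ET , endpoint?-sound e∋v

module _ {G : Graph} {S : Subset (nE G)} where
  open JoinsProperties G

  private variable
    u v w x z : Fin (nV G)
    e₀ f : Fin (nE G)

  infixr 5 _++ʷ_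

  _++ʷ_ : Walk G S u v → Walk G S v z → Walk G S u z
  [] ++ʷ q = q
  step e e∈S j p ++ʷ q = step e e∈S j (p ++ʷ q)

  reverse : Walk G S u v → Walk G S v u
  reverse [] = []
  reverse (step e e∈S j p) = reverse p ++ʷ step e e∈S (Joins-sym e j) []

  end∈verts : (p : Walk G S u v) → v ∈ₗ verts p
  end∈verts [] = here refl
  end∈verts (step e e∈S j p) = there (end∈verts p)

  ∈-++ʷ⁺ˡ : (p : Walk G S u v) (q : Walk G S v z) → x ∈ₗ verts p → x ∈ₗ verts (p ++ʷ q)
  ∈-++ʷ⁺ˡ [] q (here refl) = here refl
  ∈-++ʷ⁺ˡ (step e e∈S j p) q (here refl) = here refl
  ∈-++ʷ⁺ˡ (step e e∈S j p) q (there x∈p) = there (∈-++ʷ⁺ˡ p q x∈p)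

  ∈-++ʷ⁺ʳ : (p : Walk G S u v) (q : Walk G S v z) → x ∈ₗ verts q → x ∈ₗ verts (p ++ʷ q)
  ∈-++ʷ⁺ʳ [] q x∈q = x∈q
  ∈-++ʷ⁺ʳ (step e e∈S j p) q x∈q = there (∈-++ʷ⁺ʳ p q x∈q)

  ∈-++ʷ⁻ : (p : Walk G S u v) (q : Walk G S v z) →
    x ∈ₗ verts (p ++ʷ q) → x ∈ₗ verts p ⊎ x ∈ₗ verts q
  ∈-++ʷ⁻ [] q x∈q = inj₂ x∈q
  ∈-++ʷ⁻ (step e e∈S j p) q (here refl) = inj₁ (here refl)
  ∈-++ʷ⁻ (step e e∈S j p) q (there x∈pq) = Sum.map₁ there (∈-++ʷ⁻ p q x∈pq)

  ∈-edges-++ʷ⁺ˡ : (p : Walk G S u v) (q : Walk G S v z) → f ∈ₗ edges p → f ∈ₗ edges (p ++ʷ q)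
  ∈-edges-++ʷ⁺ˡ (step e e∈S j p) q (here refl) = here refl
  ∈-edges-++ʷ⁺ˡ (step e e∈S j p) q (there f∈p) = there (∈-edges-++ʷ⁺ˡ p q f∈p)

  ∈-edges-++ʷ⁺ʳ : (p : Walk G S u v) (q : Walk G S v z) → f ∈ₗ edges q → f ∈ₗ edges (p ++ʷ q)
  ∈-edges-++ʷ⁺ʳ [] q f∈q = f∈q
  ∈-edges-++ʷ⁺ʳ (step e e∈S j p) q f∈q = there (∈-edges-++ʷ⁺ʳ p q f∈q)

  ∈-edges-++ʷ⁻ : (p : Walk G S u v) (q : Walk G S v z) →
    f ∈ₗ edges (p ++ʷ q) → f ∈ₗ edges p ⊎ f ∈ₗ edges q
  ∈-edges-++ʷ⁻ [] q f∈q = inj₂ f∈q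
  ∈-edges-++ʷ⁻ (step e e∈S j p) q (here refl) = inj₁ (here refl)
  ∈-edges-++ʷ⁻ (step e e∈S j p) q (there f∈pq) = Sum.map₁ there (∈-edges-++ʷ⁻ p q f∈pq)

  ∈-reverse⁺ : (p : Walk G S u v) → x ∈ₗ verts p → x ∈ₗ verts (reverse p)
  ∈-reverse⁺ [] x∈p = x∈p
  ∈-reverse⁺ (step e e∈S j p) (here refl) = ∈-++ʷ⁺ʳ (reverse p) _ (there (here refl))
  ∈-reverse⁺ (step e e∈S j p) (there x∈p) = ∈-++ʷ⁺ˡ (reverse p) _ (∈-reverse⁺ p x∈p)

  ∈-reverse⁻ : (p : Walk G S u v) → x ∈ₗ verts (reverse p) → x ∈ₗ verts p
  ∈-reverse⁻ [] x∈p = x∈p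
  ∈-reverse⁻ (step e e∈S j p) x∈rp with ∈-++ʷ⁻ (reverse p) (step e e∈S (Joins-sym e j) []) x∈rp
  ... | inj₁ x∈p = there (∈-reverse⁻ p x∈p)
  ... | inj₂ (here refl) = there (here refl)
  ... | inj₂ (there (here refl)) = here refl

  ∈-edges-reverse⁻ : (p : Walk G S u v) → f ∈ₗ edges (reverse p) → f ∈ₗ edges p
  ∈-edges-reverse⁻ (step e e∈S j p) f∈rp
    with ∈-edges-++ʷ⁻ (reverse p) (step e e∈S (Joins-sym e j) []) f∈rp
  ... | inj₁ f∈p = there (∈-edges-reverse⁻ p f∈p)
  ... | inj₂ (here refl) = here refl

  Incident⇒∈verts : (p : Walk G S u v) → f ∈ₗ edges p → Incident G f z → z ∈ₗ verts p
  Incident⇒∈verts (step e e∈S j p) (here refl) f∋z with j | f∋z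
  ... | inj₁ refl | inj₁ refl = here refl
  ... | inj₁ refl | inj₂ refl = there (here refl)
  ... | inj₂ refl | inj₁ refl = there (here refl)
  ... | inj₂ refl | inj₂ refl = here refl
  Incident⇒∈verts (step e e∈S j p) (there f∈p) f∋z = there (Incident⇒∈verts p f∈p f∋z)

  split-at : (p : Walk G S u v) → x ∈ₗ verts p →
    Σ (Walk G S u x) λ p₁ → Σ (Walk G S x v) λ p₂ → p₁ ++ʷ p₂ ≡ p
  split-at p (here refl) = [] , p , refl
  split-at (step e e∈S j p) (there x∈p) =
    let p₁ , p₂ , p₁p₂≡p = split-at p x∈p
    in  step e e∈S j p₁ , p₂ , cong (step e e∈S j) p₁p₂≡p

  simple-suffix : (p : Walk G S u v) {q : Walk G S v z} → Unique (verts (p ++ʷ q)) → Unique (verts q)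
  simple-suffix [] pq! = pq!
  simple-suffix (step e e∈S j p) (_ ∷ pq!) = simple-suffix p pq!

  simple-++ʷ⇒disjoint : (p : Walk G S u v) (q : Walk G S v z) → Unique (verts (p ++ʷ q)) →
    x ∈ₗ verts p → x ∉ₗ later q
  simple-++ʷ⇒disjoint [] q q! (here refl) = Unique[x∷xs]⇒x∉xs q!
  simple-++ʷ⇒disjoint (step e e∈S j p) q pq! (here refl) x∈q =
    Unique[x∷xs]⇒x∉xs pq! (∈-++ʷ⁺ʳ p q (there x∈q))
  simple-++ʷ⇒disjoint (step e e∈S j p) q (_ ∷ pq!) (there x∈p) = simple-++ʷ⇒disjoint p q pq! x∈p

  simple-snoc : ∀ {e e∈S} (p : Walk G S u v) (j : Joins G e v w) → Unique (verts p) → w ∉ₗ verts p →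
    Unique (verts (p ++ʷ step e e∈S j []))
  simple-snoc [] j _ w∉p = unique-∷ (λ { (here refl) → w∉p (here refl) }) ([] ∷ [])
  simple-snoc {w = w} (step e e∈S j p) j′ (u∉p ∷ p!) w∉p =
    unique-∷ u∉p++w (simple-snoc p j′ p! (w∉p ∘ there))
    where
    u∉p++w : _ ∉ₗ verts (p ++ʷ _)
    u∉p++w u∈ with ∈-++ʷ⁻ p _ u∈
    ... | inj₁ u∈p = Unique[x∷xs]⇒x∉xs (u∉p ∷ p!) u∈p
    ... | inj₂ (here refl) = Unique[x∷xs]⇒x∉xs (u∉p ∷ p!) (end∈verts p)
    ... | inj₂ (there (here refl)) = w∉p (here refl)

  simple-reverse : (p : Walk G S u v) → Unique (verts p) → Unique (verts (reverse p))
  simple-reverse [] p! = p!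
  simple-reverse (step e e∈S j p) (u∉p ∷ p!) =
    simple-snoc (reverse p) (Joins-sym e j) (simple-reverse p p!)
      (Unique[x∷xs]⇒x∉xs (u∉p ∷ p!) ∘ ∈-reverse⁻ p)

  second-vertex : (p : Walk G S u v) → u ≢ v →
    ∃ λ b → (∃ λ e → e ∈ S × Joins G e u b) × b ∈ₗ verts p
  second-vertex [] u≢v = contradiction refl u≢v
  second-vertex (step e e∈S j _) _ = _ , (e , e∈S , j) , there (here refl)

  end∈later : (p : Walk G S u v) → u ≢ v → v ∈ₗ later p
  end∈later [] u≢v = contradiction refl u≢v
  end∈later (step e e∈S j p) _ = end∈verts p

  ∈-inner⁺ : (p : Walk G S u v) → x ∈ₗ verts p → x ≢ u → x ≢ v → x ∈ₗ inner p
  ∈-inner⁺ p (here refl) x≢u _ = contradiction refl x≢u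
  ∈-inner⁺ (step e e∈S j []) (there (here refl)) _ x≢v = contradiction refl x≢v
  ∈-inner⁺ {x = x} (step {w = w} e e∈S j q@(step _ _ _ _)) (there x∈q) _ x≢v with x ≟ w
  ... | yes refl = here refl
  ... | no x≢w = there (∈-inner⁺ q x∈q x≢w x≢v)

  first-edge : (p : Walk G S w v) →
    Unique (u ∷ verts p) → f ∈ₗ e₀ ∷ edges p → Incident G f u → f ≡ e₀
  first-edge p _ (here refl) _ = refl
  first-edge p p! (there f∈p) f∋u =
    contradiction (Incident⇒∈verts p f∈p f∋u) (Unique[x∷xs]⇒x∉xs p!)

  erase-loops : (p : Walk G S u v) → Σ (Path G S u v) λ q → edges (walk q) ⊆ₗ edges p
  erase-loops [] = path [] ([] ∷ []) , λ ()
  erase-loops {u = u} (step e e∈S j p) with erase-loops p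
  ... | q , q⊆p with u ∈ₗ? verts (walk q)
  ...   | no u∉q = path (step e e∈S j (walk q)) (unique-∷ u∉q (simple q)) ,
                   λ { (here refl) → here refl ; (there f∈q) → there (q⊆p f∈q) }
  ...   | yes u∈q with split-at (walk q) u∈q
  ...     | q₁ , q₂ , refl =
    path q₂ (simple-suffix q₁ (simple q)) , there ∘ q⊆p ∘ ∈-edges-++ʷ⁺ʳ q₁ q₂

  simple-length≤ : (p : Walk G S u v) → Unique (verts p) → length (verts p) ≤ nV G
  simple-length≤ p p! =
    subst (length (verts p) ≤_) (∣⊤∣≡n (nV G)) (unique⊆⇒length≤ ⊤ p! (All.universal (λ _ → ∈⊤) _))

module Growth {G : Graph} {S : Subset (nE G)} {t : Fin (nV G)} (Inv : ∀ {c} → Walk G S c t → Set) where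

  record Extension {c} (p : Walk G S c t) : Set where
    constructor extend
    field
      {b} : Fin (nV G)
      e : Fin (nE G)
      e∈S : e ∈ S
      joins : Joins G e b c
      fresh : b ∉ₗ verts p
      invariant : Inv (step e e∈S joins p)

  grow : {Done : ∀ {c} → Walk G S c t → Set} →
    (∀ {c} (p : Walk G S c t) → Unique (verts p) → Inv p → Done p ⊎ Extension p) →
    ∀ {c} (p : Walk G S c t) → Unique (verts p) → Inv p →
    Σ (Fin (nV G)) λ c′ → Σ (Walk G S c′ t) λ q → Unique (verts q) × Inv q × Done q
  grow {Done} next p p! inv = go (nV G) p p! inv (s≤s (m≤n+m _ _))
    where
    go : (fuel : ℕ) → ∀ {c} (p : Walk G S c t) → Unique (verts p) → Inv p →
      nV G < length (verts p) + fuel →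
      Σ (Fin (nV G)) λ c′ → Σ (Walk G S c′ t) λ q → Unique (verts q) × Inv q × Done q
    go fuel p p! inv bound with next p p! inv
    ... | inj₁ done = _ , p , p! , inv , done
    ... | inj₂ (extend e e∈S j fresh inv′) with fuel
    ...   | zero = contradiction (simple-length≤ p p!) (<⇒≱ (subst (nV G <_) (+-identityʳ _) bound))
    ...   | suc fuel′ =
      go fuel′ (step e e∈S j p) (unique-∷ fresh p!) inv′ (subst (nV G <_) (+-suc _ fuel′) bound)

-- Acyclic edge sets

module Acyclic {G : Graph} {S : Subset (nE G)} (acyclic : ¬ Cycle G S) where
  open JoinsProperties G

  edge-on-every-return : ∀ {e u w} → e ∈ S → Joins G e u w → (W : Walk G S w u) → e ∈ₗ edges W
  edge-on-every-return {e} e∈S j W with e ∈ₗ? edges W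
  ... | yes e∈W = e∈W
  ... | no e∉W =
    let p , p⊆W = erase-loops W in contradiction (e , _ , _ , e∈S , j , p , e∉W ∘ p⊆W) acyclic

  path⊆walk : ∀ {u v} (p : Path G S u v) (W : Walk G S u v) → verts (walk p) ⊆ₗ verts W
  path⊆walk (path [] _) W (here refl) = here refl
  path⊆walk (path (step e e∈S j p) _) W (here refl) = here refl
  path⊆walk (path (step {w = w} e e∈S j p) u∷p!@(_ ∷ p!)) W (there x∈p) with w ∈ₗ? verts W
  ... | no w∉W = contradiction (edge-on-every-return e∈S j (p ++ʷ reverse W)) e∉p++W
    where
    e∉p++W : e ∉ₗ edges (p ++ʷ reverse W)
    e∉p++W e∈ with ∈-edges-++ʷ⁻ p (reverse W) e∈
    ... | inj₁ e∈p = Unique[x∷xs]⇒x∉xs u∷p! (Incident⇒∈verts p e∈p (Joins⇒Incidentˡ e j))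
    ... | inj₂ e∈W = w∉W (Incident⇒∈verts W (∈-edges-reverse⁻ W e∈W) (Joins⇒Incidentʳ e j))
  ... | yes w∈W with path⊆walk (path p p!) (step e e∈S (Joins-sym e j) W) x∈p
  ...   | here refl = w∈W
  ...   | there x∈W = x∈W

  path-through⇒prefix-avoids : ∀ {m x y} → x ≢ y → (p : Path G S m y) → x ∈ₗ verts (walk p) →
    (q : Path G S m x) → y ∉ₗ verts (walk q)
  path-through⇒prefix-avoids x≢y (path p p!) x∈p q y∈q with split-at p x∈p
  ... | p₁ , p₂ , refl = simple-++ʷ⇒disjoint p₁ p₂ p! (path⊆walk q p₁ y∈q) (end∈later p₂ x≢y)

  neighbour∉walk : ∀ {z z′ y e} (p : Walk G S z y) → e ∈ S → Joins G e z z′ →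
    e ∉ₗ edges p → z′ ∉ₗ verts p
  neighbour∉walk p e∈S j e∉p z′∈p with split-at p z′∈p
  ... | p₁ , p₂ , refl =
    e∉p (∈-edges-++ʷ⁺ˡ p₁ p₂ (∈-edges-reverse⁻ p₁ (edge-on-every-return e∈S j (reverse p₁))))

module _ {G : Graph} {S : Subset (nE G)} (acyclic : ¬ Cycle G S)
  {Sink : Fin (nV G) → Set} {_⇝_ : Fin (nV G) → Fin (nV G) → Set}
  (⇝-edge : ∀ {c b} → c ⇝ b → ∃ λ e → e ∈ S × Joins G e c b)
  (⇝-asym : ∀ {c b} → c ⇝ b → ¬ b ⇝ c)
  (sink-or-⇝ : ∀ c → Sink c ⊎ ∃ (c ⇝_)) where
  open JoinsProperties G
  open Acyclic acyclic

  private
    -- Paths grow at their start, so the first step of p is the most recent move.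
    Arrived : ∀ {c t} → Walk G S c t → Set
    Arrived [] = Unit
    Arrived (step {u = c} {w = a} _ _ _ _) = a ⇝ c

    no-return : ∀ {c b t e} (p : Walk G S c t) → Unique (verts p) → Arrived p →
      c ⇝ b → e ∈ S → Joins G e c b → b ∉ₗ verts p
    no-return [] _ _ _ _ j (here refl) = Joins⇒≢ _ j refl
    no-return {c} {e = e} p@(step e₀ _ j₀ p′) p! a⇝c c⇝b e∈S j b∈p with e ∈ₗ? edges p
    ... | no e∉p = neighbour∉walk p e∈S j e∉p b∈p
    ... | yes e∈p with first-edge p′ p! e∈p (Joins⇒Incidentˡ e j)
    ...   | refl = ⇝-asym a⇝c (subst (c ⇝_) (Joins-unique e j j₀) c⇝b)

  -- Following ⇝ from t traces a simple path: asymmetry forbids stepping back along the edge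
  -- just used and acyclicity forbids any other return, so by finiteness a sink is reached.
  sink-reachable : Fin (nV G) → ∃ Sink
  sink-reachable t with grow next [] ([] ∷ []) tt
    where
    open Growth (Arrived {t = t})
    next : ∀ {c} (p : Walk G S c t) → Unique (verts p) → Arrived p → Sink c ⊎ Extension p
    next {c} p p! arrived with sink-or-⇝ c
    ... | inj₁ sink = inj₁ sink
    ... | inj₂ (b , c⇝b) with ⇝-edge c⇝b
    ...   | e , e∈S , j = inj₂ (extend e e∈S (Joins-sym e j) (no-return p p! arrived c⇝b e∈S j) c⇝b)
  ... | c , _ , _ , _ , sink = c , sink

-- Subtrees

record LeafPathThrough {G : Graph} (T : Subtree G) (r : Fin (nV G)) : Set where
  constructor leaf-path
  field
    {start end} : Fin (nV G)
    start-leaf : IsLeaf G T start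
    end-leaf : IsLeaf G T end
    route : Path G (ET T) start end
    r∈route : r ∈ₗ verts (walk route)

module SubtreeProperties {G : Graph} (T : Subtree G) where
  open IsTree (isTree T)
  open Acyclic acyclic public
  open JoinsProperties G
  open Degree G

  incident∈VT : ∀ {e v} → e ∈ ET T → Incident G e v → v ∈ VT T
  incident∈VT e∈T (inj₁ refl) = proj₁ (closed _ e∈T)
  incident∈VT e∈T (inj₂ refl) = proj₂ (closed _ e∈T)

  leaf≢internal : ∀ {u r} → IsLeaf G T u → IsInternal G T r → u ≢ r
  leaf≢internal (_ , deg≡1) (_ , 2≤deg) refl =
    contradiction (subst (2 ≤_) deg≡1 2≤deg) λ { (s≤s ()) }

  extend-to-leaf : ∀ {z t} (p : Walk G (ET T) z t) → Unique (verts p) → z ≢ t →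
    Σ (Fin (nV G)) λ u → IsLeaf G T u ×
      Σ (Walk G (ET T) u t) λ q → Unique (verts q) × u ≢ t × verts p ⊆ₗ verts q
  extend-to-leaf {t = t} p p! z≢t with grow next p p! (z≢t , id)
    where
    Inv : ∀ {c} → Walk G (ET T) c t → Set
    Inv {c} q = c ≢ t × verts p ⊆ₗ verts q
    open Growth Inv
    next : ∀ {c} (q : Walk G (ET T) c t) → Unique (verts q) → Inv q → IsLeaf G T c ⊎ Extension q
    next [] _ (c≢t , _) = contradiction refl c≢t
    next {c} q@(step e₀ e₀∈T j₀ q′) q! (_ , p⊆q)
      with ∣p∣≡1⊎another (incident-edges (ET T) c) (∈-incident⁺ e₀∈T (Joins⇒Incidentˡ e₀ j₀))
    ... | inj₁ deg≡1 = inj₁ (incident∈VT e₀∈T (Joins⇒Incidentˡ e₀ j₀) , deg≡1)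
    ... | inj₂ (e , e∈inc , e≢e₀) =
      let e∈T , e∋c = ∈-incident⁻ e∈inc
          z , j = Incident⇒Joins e e∋c
          z∉q = neighbour∉walk q e∈T j (λ e∈q → e≢e₀ (first-edge q′ q! e∈q e∋c))
      in  inj₂ (extend e e∈T (Joins-sym e j) z∉q ((λ { refl → z∉q (end∈verts q) }) , there ∘ p⊆q))
  ... | u , q , q! , (u≢t , p⊆q) , u-leaf = u , u-leaf , q , q! , u≢t , p⊆q

  -- Extend the path n₁ – r – n₂ along two edges at r to a leaf at one end, then at the other.
  internal⇒leaf-path : ∀ {r} → IsInternal G T r → LeafPathThrough T r
  internal⇒leaf-path {r} (_ , 2≤deg) with 2≤∣p∣⇒two-elements (incident-edges (ET T) r) 2≤deg
  ... | e₁ , e₂ , e₁∈inc , e₂∈inc , e₂≢e₁ =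
    let e₁∈T , e₁∋r = ∈-incident⁻ e₁∈inc
        e₂∈T , e₂∋r = ∈-incident⁻ e₂∈inc
        n₁ , j₁ = Incident⇒Joins e₁ e₁∋r
        n₂ , j₂ = Incident⇒Joins e₂ e₂∋r
        n₁∉r→n₂ = neighbour∉walk (step e₂ e₂∈T j₂ []) e₁∈T j₁ λ { (here refl) → e₂≢e₁ refl }
        p₀ = step e₁ e₁∈T (Joins-sym e₁ j₁) (step e₂ e₂∈T j₂ [])
        p₀! = unique-∷ n₁∉r→n₂ (unique-∷ (λ { (here r≡n₂) → Joins⇒≢ e₂ j₂ r≡n₂ }) ([] ∷ []))
        u , u-leaf , q₁ , q₁! , u≢n₂ , p₀⊆q₁ =
          extend-to-leaf p₀ p₀! (n₁∉r→n₂ ∘ there ∘ here)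
        v , v-leaf , q₂ , q₂! , _ , q₁⊆q₂ =
          extend-to-leaf (reverse q₁) (simple-reverse q₁ q₁!) (u≢n₂ ∘ sym)
    in  leaf-path v-leaf u-leaf (path q₂ q₂!) (q₁⊆q₂ (∈-reverse⁺ q₁ (p₀⊆q₁ (there (here refl)))))

-- Completely independent Steiner trees

module _ {G : Graph} {S : Subset (nE G)} where

  AvoidingWalk : Fin (nV G) → Fin (nV G) → Fin (nV G) → Set
  AvoidingWalk r x y = Σ (Walk G S x y) λ p → r ∉ₗ verts p

  avoiding-isPartialEquivalence : ∀ {r} → IsPartialEquivalence (AvoidingWalk r)
  avoiding-isPartialEquivalence = record
    { sym = λ (p , r∉p) → reverse p , r∉p ∘ ∈-reverse⁻ p
    ; trans = λ (p , r∉p) (q , r∉q) → p ++ʷ q , [ r∉p , r∉q ]′ ∘ ∈-++ʷ⁻ p q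
    }

-- S may contain x and y: only the inner vertices of the walk have to avoid it.
Inseparable : (G : Graph) → Subset (nV G) → ℕ → Set
Inseparable G R s = ∀ {x y} → x ∈ R → y ∈ R → x ≢ y → (S : Subset (nV G)) → ∣ S ∣ ≤ s →
  Σ (Subset (nE G)) λ ES → Σ (Walk G ES x y) λ p → All (_∉ S) (inner p)

module CIST {G : Graph} {R : Subset (nV G)} {k : ℕ} {T : Fin k → Subtree G} (cist : IsCIST G R k T) where
  private
    steiner = proj₁ cist
    disjoint = proj₂ cist

  tree-path : ∀ i {x y} → x ∈ R → y ∈ R → Path G (ET (T i)) x y
  tree-path i x∈R y∈R =
    IsTree.connected (isTree (T i)) _ _ (proj₁ (steiner i) x∈R) (proj₁ (steiner i) y∈R)

  CIST⇒inseparable : ∀ {s} → s < k → Inseparable G R s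
  CIST⇒inseparable s<k {x} {y} x∈R y∈R x≢y S ∣S∣≤s =
    let i , pᵢ-avoids-S = disjoint-lists-avoid (inner ∘ p) inners-disjoint S (≤-<-trans ∣S∣≤s s<k)
    in  ET (T i) , p i , pᵢ-avoids-S
    where
    p : ∀ i → Walk G (ET (T i)) x y
    p i = walk (tree-path i x∈R y∈R)
    inners-disjoint : ∀ {i j} → i ≢ j → Disjoint (inner (p i)) (inner (p j))
    inners-disjoint {i} {j} i≢j (z∈pᵢ , z∈pⱼ) =
      proj₂ (disjoint x y x∈R y∈R x≢y i j i≢j (tree-path i x∈R y∈R) (tree-path j x∈R y∈R))
        _ z∈pᵢ z∈pⱼ

  through⇒others-avoid : ∀ {i j r x y} → i ≢ j → x ∈ R → y ∈ R → x ≢ y → r ≢ x → r ≢ y →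
    (pᵢ : Path G (ET (T i)) x y) → r ∈ₗ verts (walk pᵢ) →
    (pⱼ : Path G (ET (T j)) x y) → r ∉ₗ verts (walk pⱼ)
  through⇒others-avoid {i} {j} {r} {x} {y} i≢j x∈R y∈R x≢y r≢x r≢y pᵢ r∈pᵢ pⱼ r∈pⱼ =
    proj₂ (disjoint x y x∈R y∈R x≢y i j i≢j pᵢ pⱼ) r
      (∈-inner⁺ (walk pᵢ) r∈pᵢ r≢x r≢y) (∈-inner⁺ (walk pⱼ) r∈pⱼ r≢x r≢y)

  avoiding-cover : ∀ {i j r x y} → i ≢ j → x ∈ R → y ∈ R → r ≢ x → r ≢ y →
    ¬ AvoidingWalk {G = G} {S = ET (T i)} r x y → AvoidingWalk {G = G} {S = ET (T j)} r x y
  avoiding-cover {i} {j} {r} {x} {y} i≢j x∈R y∈R r≢x r≢y no-avoidance with x ≟ y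
  ... | yes refl = [] , λ { (here r≡x) → r≢x r≡x }
  ... | no x≢y with r ∈ₗ? verts (walk (tree-path i x∈R y∈R))
  ...   | no r∉pᵢ = contradiction (_ , r∉pᵢ) no-avoidance
  ...   | yes r∈pᵢ =
    walk pⱼ , through⇒others-avoid i≢j x∈R y∈R x≢y r≢x r≢y (tree-path i x∈R y∈R) r∈pᵢ pⱼ
    where pⱼ = tree-path j x∈R y∈R

  Separates : Fin k → Fin (nV G) → Set
  Separates i r =
    ∃₂ λ u v → (u ∈ R × r ≢ u) × (v ∈ R × r ≢ v) × ¬ AvoidingWalk {G = G} {S = ET (T i)} r u v

  leaf-path⇒separates : ∀ i {r} → IsInternal G (T i) r → LeafPathThrough (T i) r → Separates i r
  leaf-path⇒separates i r-internal (leaf-path u-leaf v-leaf route r∈route) =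
    _ , _ , (proj₂ (steiner i) _ u-leaf , leaf≢internal u-leaf r-internal ∘ sym)
          , (proj₂ (steiner i) _ v-leaf , leaf≢internal v-leaf r-internal ∘ sym)
          , λ (p , r∉p) → r∉p (path⊆walk route p r∈route)
    where open SubtreeProperties (T i)

  CIST⇒internal-disjoint : ∀ {i j r} → i ≢ j → IsInternal G (T i) r → IsInternal G (T j) r → ⊥
  CIST⇒internal-disjoint {i} {j} i≢j rᵢ rⱼ = both-separate (separates i rᵢ) (separates j rⱼ)
    where
    separates : ∀ i {r} → IsInternal G (T i) r → Separates i r
    separates i r-internal =
      leaf-path⇒separates i r-internal (SubtreeProperties.internal⇒leaf-path (T i) r-internal)
    both-separate : ∀ {r} → Separates i r → Separates j r → ⊥
    both-separate (_ , _ , Pu₁ , Pv₁ , r-splits-Tᵢ) (_ , _ , Pu₂ , Pv₂ , r-splits-Tⱼ) =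
      not-both-split avoiding-isPartialEquivalence avoiding-isPartialEquivalence
        (λ (x∈R , r≢x) (y∈R , r≢y) → avoiding-cover i≢j x∈R y∈R r≢x r≢y)
        Pu₁ Pv₁ Pu₂ Pv₂ r-splits-Tᵢ r-splits-Tⱼ

-- Tree decompositions

module Decomposition {G : Graph} (TD : TreeDecomposition G) where
  private
    Node = Fin (nV (D TD))
    module JD = JoinsProperties (D TD)
    open Acyclic (IsTree.acyclic (D-tree TD))

  D-path : (n m : Node) → Path (D TD) ⊤ n m
  D-path n m = IsTree.connected (D-tree TD) n m ∈⊤ ∈⊤

  module Edge {a c e} (ac : Joins (D TD) e a c) where

    -- n lies on c's side of the edge a–c of the decomposition tree.
    Beyond : Node → Set
    Beyond n = c ∈ₗ verts (walk (D-path n a))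

    ¬beyond⇒via-a : ∀ {n} → ¬ Beyond n → a ∈ₗ verts (walk (D-path n c))
    ¬beyond⇒via-a {n} c∉na =
      path⊆walk (path (na ++ʷ step e ∈⊤ ac []) (simple-snoc na ac (simple (D-path n a)) c∉na))
        (walk (D-path n c)) (∈-++ʷ⁺ˡ na _ (end∈verts na))
      where na = walk (D-path n a)

    crossing : ∀ {n m} → Beyond n → ¬ Beyond m →
      a ∈ₗ verts (walk (D-path n m)) × c ∈ₗ verts (walk (D-path n m))
    crossing {n} {m} c∈na c∉ma = a∈nm , c∈nm
      where
      nm = walk (D-path n m)
      c∈nm : c ∈ₗ verts nm
      c∈nm with ∈-++ʷ⁻ nm _ (path⊆walk (D-path n a) (nm ++ʷ walk (D-path m a)) c∈na)
      ... | inj₁ c∈nm = c∈nm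
      ... | inj₂ c∈ma = contradiction c∈ma c∉ma
      a∈nm : a ∈ₗ verts nm
      a∈nm with ∈-++ʷ⁻ (reverse nm) _
                  (path⊆walk (D-path m c) (reverse nm ++ʷ walk (D-path n c)) (¬beyond⇒via-a c∉ma))
      ... | inj₁ a∈mn = ∈-reverse⁻ nm a∈mn
      ... | inj₂ a∈nc = contradiction a∈nc
              (path-through⇒prefix-avoids (JD.Joins⇒≢ e ac ∘ sym) (D-path n a) c∈na (D-path n c))

    separator : Subset (nV G)
    separator = bag TD a ∩ bag TD c

    shared⇒∈separator : ∀ {g n m} → g ∈ bag TD n → Beyond n → g ∈ bag TD m → ¬ Beyond m →
      g ∈ separator
    shared⇒∈separator {g} {n} {m} g∈n n-beyond g∈m m-not-beyond =
      x∈p∩q⁺ (along (proj₁ crosses) , along (proj₂ crosses))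
      where
      crosses = crossing n-beyond m-not-beyond
      along : ∀ {d} → d ∈ₗ verts (walk (D-path n m)) → g ∈ bag TD d
      along d∈nm = coherent TD g n m g∈n g∈m (D-path n m) _ d∈nm

    InBeyondBag : Fin (nV G) → Set
    InBeyondBag g = ∃ λ n → Beyond n × g ∈ bag TD n

    edge-stays-beyond : ∀ {f g h} → Joins G f g h → InBeyondBag g → g ∉ separator → InBeyondBag h
    edge-stays-beyond {f} j (n , n-beyond , g∈n) g∉sep with cover-e TD f
    ... | d , f₁∈d , f₂∈d with JoinsProperties.Joins-ends G f j f₁∈d f₂∈d
    ...   | g∈d , h∈d with c ∈ₗ? verts (walk (D-path d a))
    ...     | yes d-beyond = d , d-beyond , h∈d
    ...     | no d-not-beyond = contradiction (shared⇒∈separator g∈n n-beyond g∈d d-not-beyond) g∉sep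

    walk-stays-beyond : ∀ {ES g h} (p : Walk G ES g h) → InBeyondBag g → g ∉ separator →
      All (_∉ separator) (inner p) → InBeyondBag h
    walk-stays-beyond [] g-beyond _ _ = g-beyond
    walk-stays-beyond (step f _ j []) g-beyond g∉sep _ = edge-stays-beyond j g-beyond g∉sep
    walk-stays-beyond (step f _ j p@(step _ _ _ _)) g-beyond g∉sep (g′∉sep ∷ p∉sep) =
      walk-stays-beyond p (edge-stays-beyond j g-beyond g∉sep) g′∉sep p∉sep

  module _ {w : ℕ} {R : Subset (nV G)}
    (narrow : WidthAtMost TD w) (inseparable : Inseparable G R (suc w)) where

    -- c ⇝ b: b is the neighbour of c towards a bag holding a vertex of R that bag c misses.
    _⇝_ : Node → Node → Set
    c ⇝ b = (∃ λ e → Joins (D TD) e c b) ×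
            ∃₂ λ y d → y ∈ R × y ∉ bag TD c × y ∈ bag TD d × b ∈ₗ verts (walk (D-path d c))

    -- Otherwise the adhesion set bag a ∩ bag c, of size at most w + 1, would separate x from y.
    ⇝-asym : ∀ {a c} → a ⇝ c → ¬ c ⇝ a
    ⇝-asym {a} {c} ((e , ac) , x , dx , x∈R , x∉a , x∈dx , c∈dx→a)
                   (_ , y , dy , y∈R , y∉c , y∈dy , a∈dy→c) =
      let _ , p , p-avoids = inseparable x∈R y∈R x≢y separator ∣separator∣≤w+1
          _ , n-beyond , y∈n = walk-stays-beyond p (dx , c∈dx→a , x∈dx) (x∉a ∘ proj₁ ∘ x∈p∩q⁻ _ _) p-avoids
      in  y∉c (proj₂ (x∈p∩q⁻ _ _ (shared⇒∈separator y∈n n-beyond y∈dy dy-not-beyond)))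
      where
      open Edge ac
      ∣separator∣≤w+1 : ∣ separator ∣ ≤ suc w
      ∣separator∣≤w+1 = ≤-trans (∣p∩q∣≤∣p∣ (bag TD a) (bag TD c)) (narrow a)
      dy-not-beyond : ¬ Beyond dy
      dy-not-beyond = path-through⇒prefix-avoids (JD.Joins⇒≢ e ac) (D-path dy _) a∈dy→c (D-path dy _)
      x≢y : x ≢ y
      x≢y refl = x∉a (proj₁ (x∈p∩q⁻ _ _ (shared⇒∈separator x∈dx c∈dx→a y∈dy dy-not-beyond)))

    sink-or-⇝ : ∀ c → R ⊆ bag TD c ⊎ ∃ (c ⇝_)
    sink-or-⇝ c with any? (λ y → (y ∈? R) ×-dec ¬? (y ∈? bag TD c))
    ... | no R⊆c =
      inj₁ λ {y} y∈R → decidable-stable (y ∈? bag TD c) λ y∉c → R⊆c (y , y∈R , y∉c)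
    ... | yes (y , y∈R , y∉c) =
      let d , y∈d = cover-v TD y
          b , (e , e∈⊤ , cb) , b∈c→d = second-vertex (walk (D-path c d)) λ { refl → y∉c y∈d }
          b∈d→c = ∈-reverse⁻ _ (path⊆walk (D-path c d) (reverse (walk (D-path d c))) b∈c→d)
      in  inj₂ (b , (e , cb) , y , d , y∈R , y∉c , y∈d , b∈d→c)

    inseparable⇒⊆bag : Nonempty R → ∃ λ a → R ⊆ bag TD a
    inseparable⇒⊆bag (x , _) =
      sink-reachable (IsTree.acyclic (D-tree TD)) (λ ((e , cb) , _) → e , ∈⊤ , cb) ⇝-asym sink-or-⇝
        (proj₁ (cover-v TD x))

theorem3p21 : (G : Graph) → IsConnected G → (w : ℕ) → TreewidthAtMost G w →
    (R : Subset (nV G)) → 2 ≤ ∣ R ∣ →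
    (k : ℕ) (T : Fin k → Subtree G) → IsNonPendantCIST G R k T →
    k ≤ suc w
-- The bound holds without connectivity of G, so that hypothesis is unused.
theorem3p21 G _ w (TD , narrow) R 2≤∣R∣ k T (cist , non-pendant) = ≮⇒≥ λ w+1<k →
  no-bag-holds-R w+1<k
    (Decomposition.inseparable⇒⊆bag TD narrow (CIST⇒inseparable w+1<k) (1≤∣p∣⇒nonempty R 1≤∣R∣))
  where
  open CIST {G} {R} {k} {T} cist
  1≤∣R∣ : 1 ≤ ∣ R ∣
  1≤∣R∣ = ≤-trans (s≤s z≤n) 2≤∣R∣
  root : Fin k → Fin (nV G)
  root i = proj₁ (non-pendant i)
  root∈R : ∀ i → root i ∈ R
  root∈R i = proj₁ (proj₂ (non-pendant i))
  root-internal : ∀ i → IsInternal G (T i) (root i)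
  root-internal i = proj₂ (proj₂ (non-pendant i))
  no-bag-holds-R : suc w < k → ¬ (∃ λ a → R ⊆ bag TD a)
  no-bag-holds-R w+1<k (a , R⊆a)
    with pigeonhole-⊆ (bag TD a) root (R⊆a ∘ root∈R) (≤-<-trans (narrow a) w+1<k)
  ... | i , j , i≢j , same =
    CIST⇒internal-disjoint i≢j (root-internal i) (subst (IsInternal G (T j)) (sym same) (root-internal j))
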